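{- Let $p_1\neq p_2$ be odd primes. If there exists $k\ge 1$ such that $2p_1$ flanks $2p_2$ at distance $1$ at $k$, then $p_1\in\{3,7\}$.
   Context: For integers $k\ge 0$ and $n\ge 1$, $\sigma_k(n)=\sum_{d\mid n} d^k$ and $\phi(n)$ is Euler's totient function. For each $k\geq 0$, $S_k$ denotes the set of composite positive integers $n$ satisfying $n\cdot\sigma_k(n)\equiv 2 \pmod{\phi(n)}$. For $\ell\in\mathbb{N}$ and $k\ge \ell$, $n_*$ flanks $n$ at distance $\ell$ at $k$ if $n\in S_k$, $n_*\in S_{k-\ell}$ and $n_*\in S_{k+\ell}$. -}

module Defs where

open import Data.Nat using (ℕ; suc; _+_; _*_; _^_; _∸_; _≟_)
open import Data.Nat.Divisibility using (_∣?_)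
open import Data.Nat.GCD using (gcd)
open import Data.Nat.Primality using (Composite)
open import Data.List using (List; filter; map; length; upTo)
open import Data.Nat.ListAction using (sum)
open import Data.Integer as ℤ using (ℤ; +_; _-_)
open import Data.Integer.Divisibility using () renaming (_∣_ to _∣ℤ_)
open import Data.Product using (_×_)
open import Relation.Binary.PropositionalEquality using (_≡_)

divisors : ℕ → List ℕ
divisors n = filter (λ d → d ∣? n) (map suc (upTo n))

σ : ℕ → ℕ → ℕ
σ k n = sum (map (λ d → d ^ k) (divisors n))

φ : ℕ → ℕ
φ n = length (filter (λ i → gcd i n ≟ 1) (map suc (upTo n)))

_≡ₘ_[mod_] : ℕ → ℕ → ℕ → Set
a ≡ₘ b [mod m ] = (+ m) ∣ℤ ((+ a) - (+ b))

S : ℕ → ℕ → Set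
S k n = Composite n × ((n * σ k n) ≡ₘ 2 [mod (φ n) ])

-- n* flanks n at distance ℓ at k  (assumes k ≥ ℓ, so k ∸ ℓ is genuine subtraction)
Flanks : ℕ → ℕ → ℕ → ℕ → Set
Flanks nstar n ℓ k = S k n × S (k ∸ ℓ) nstar × S (k + ℓ) nstar

{-# OPTIONS --safe #-}
module Submission where

-- For an odd prime p = 1 + 2q the divisors of 2p are 1, 2, p, 2p, so
-- σ_j(2p) = (1 + 2^j)(1 + p^j), and φ(2p) = 2q.  As p ≡ 1 (mod 2q), the
-- condition 2p ∈ S_j reads 4(1 + 2^j) ≡ 2 (mod 2q), i.e. q ∣ 1 + 2^(j+1).
-- Flanking at distance 1 at k gives this for j = k - 1 and j = k + 1, so q
-- divides 4(1 + 2^k) - (1 + 2^(k+2)) = 3, whence p ∈ {3, 7}.  Only the two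
-- conditions on n_* = 2p₁ are needed.

open import Defs
open import Data.Nat.Base
open import Data.Nat.Properties
open import Algebra.Properties.CommutativeSemigroup *-commutativeSemigroup using (xy∙z≈xz∙y)
open import Data.Nat.Divisibility
open import Data.Nat.GCD using (gcd)
open import Data.Nat.Coprimality using (coprime⇒gcd≡1; gcd≡1⇒coprime)
open import Data.Nat.Primality
  using (Prime; prime?; prime⇒irreducible; prime⇒nonZero; prime⇒nonTrivial; euclidsLemma; irreducible[2])
open import Data.Nat.ListAction using (sum)
open import Data.Nat.Tactic.RingSolver using (solve-∀)
open import Data.List.Base using (List; []; _∷_; [_]; _++_; filter; map; length; upTo)
open import Data.List.Properties
  using (upTo-∷ʳ; map-++; filter-++; filter-accept; filter-reject; length-++; ++-identityʳ)
open import Data.Product using (∃; _×_; _,_; proj₁; proj₂)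
open import Data.Sum using (_⊎_; inj₁; inj₂; map₂)
open import Function using (_∘_)
open import Relation.Nullary using (¬_; contradiction)
open import Relation.Nullary.Decidable using (toWitness)
open import Relation.Unary using (Pred; Decidable)
open import Relation.Binary.PropositionalEquality
  using (_≡_; _≢_; refl; sym; trans; cong; cong₂; subst; subst₂; module ≡-Reasoning)

m∣n∧0<n<2*m⇒n≡m : ∀ {m n} → m ∣ n → 0 < n → n < 2 * m → n ≡ m
m∣n∧0<n<2*m⇒n≡m {m} (divides 1 refl)             _ _    = *-identityˡ m
m∣n∧0<n<2*m⇒n≡m {m} (divides (suc (suc c)) refl) _ n<2m =
  contradiction (+-monoʳ-≤ m (+-monoʳ-≤ m z≤n)) (<⇒≱ n<2m)

2∤1+2*a : ∀ a → ¬ 2 ∣ 1 + 2 * a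
2∤1+2*a a (divides c 1+2a≡c*2) = even≢odd c a (sym (trans 1+2a≡c*2 (*-comm c 2)))

d∣m∧d∣n⇒gcd[m,n]≢1 : ∀ {d m n} → d ≢ 1 → d ∣ m → d ∣ n → gcd m n ≢ 1
d∣m∧d∣n⇒gcd[m,n]≢1 d≢1 d∣m d∣n gcd≡1 = d≢1 (gcd≡1⇒coprime gcd≡1 (d∣m , d∣n))

[m*n]^k≡m^k*n^k : ∀ m n k → (m * n) ^ k ≡ m ^ k * n ^ k
[m*n]^k≡m^k*n^k m n zero    = refl
[m*n]^k≡m^k*n^k m n (suc k) =
  trans (cong (m * n *_) ([m*n]^k≡m^k*n^k m n k)) ([m*n]*[o*p]≡[m*o]*[n*p] m n (m ^ k) (n ^ k))

[1+m]^n≡1+m*k : ∀ m n → ∃ λ k → (1 + m) ^ n ≡ 1 + m * k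
[1+m]^n≡1+m*k m zero    = 0 , cong suc (sym (*-zeroʳ m))
[1+m]^n≡1+m*k m (suc n) with [1+m]^n≡1+m*k m n
... | k , eq = 1 + k + m * k , trans (cong ((1 + m) *_) eq) (expand m k)
  where
    expand : ∀ m k → (1 + m) * (1 + m * k) ≡ 1 + m * (1 + k + m * k)
    expand = solve-∀

d∣1+x∧d∣1+4x⇒d∣3 : ∀ {d} x → d ∣ 1 + x → d ∣ 1 + 2 * (2 * x) → d ∣ 3
d∣1+x∧d∣1+4x⇒d∣3 {d} x d∣1+x d∣1+4x =
  ∣m+n∣m⇒∣n (subst (d ∣_) (split x) (∣n⇒∣m*n 4 d∣1+x)) d∣1+4x
  where
    split : ∀ x → 4 * (1 + x) ≡ 1 + 2 * (2 * x) + 3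
    split = solve-∀

-- Divisibility in ℤ is divisibility of absolute values, and + (2 + n) - + 2 reduces to + n.
2+n≡ₘ2⇒m∣n : ∀ {m n} → (2 + n) ≡ₘ 2 [mod m ] → m ∣ n
2+n≡ₘ2⇒m∣n m∣n = m∣n

even⊎odd : ∀ n → ∃ (λ q → n ≡ 2 * q) ⊎ ∃ (λ q → n ≡ 1 + 2 * q)
even⊎odd zero = inj₁ (0 , refl)
even⊎odd (suc n) with even⊎odd n
... | inj₁ (q , refl) = inj₂ (q , refl)
... | inj₂ (q , refl) = inj₁ (suc q , sym (*-suc 2 q))

odd-prime : ∀ {p} → Prime p → p ≢ 2 → ∃ λ q → p ≡ 1 + 2 * q
odd-prime pp p≢2 with even⊎odd _
... | inj₂ odd = odd
... | inj₁ (q , refl) with prime⇒irreducible pp (m∣m*n q)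
...   | inj₁ ()
...   | inj₂ 2≡2q = contradiction (sym 2≡2q) p≢2

prime[3] : Prime 3
prime[3] = toWitness {a? = prime? 3} _

-- The cofactor of 2q is (2(1 + 2q)(1 + t)(2 + 2qa) − 4(1 + t)) / 2q.
expansion-mod-2q : ∀ q t a → 2 * (1 + 2 * q) * ((1 + t) * (1 + (1 + 2 * q * a)))
                           ≡ 2 + (2 * q * (2 * (1 + t) * (2 + a + 2 * q * a)) + 2 * (1 + 2 * t))
expansion-mod-2q = solve-∀

range : ℕ → List ℕ
range n = map suc (upTo n)

range-suc : ∀ n → range (suc n) ≡ range n ++ [ suc n ]
range-suc n = trans (cong (map suc) (sym (upTo-∷ʳ n))) (map-++ suc (upTo n) [ n ])

module _ {ℓ} {P : Pred ℕ ℓ} (P? : Decidable P) where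

  filter-range-accept : ∀ {n} → P (suc n) →
                        filter P? (range (suc n)) ≡ filter P? (range n) ++ [ suc n ]
  filter-range-accept {n} Pn = begin
    filter P? (range (suc n))                  ≡⟨ cong (filter P?) (range-suc n) ⟩
    filter P? (range n ++ [ suc n ])           ≡⟨ filter-++ P? (range n) [ suc n ] ⟩
    filter P? (range n) ++ filter P? [ suc n ]
      ≡⟨ cong (filter P? (range n) ++_) (filter-accept P? Pn) ⟩
    filter P? (range n) ++ [ suc n ]           ∎
    where open ≡-Reasoning

  filter-range-reject : ∀ {n} → ¬ P (suc n) → filter P? (range (suc n)) ≡ filter P? (range n)
  filter-range-reject {n} ¬Pn = begin
    filter P? (range (suc n))                  ≡⟨ cong (filter P?) (range-suc n) ⟩
    filter P? (range n ++ [ suc n ])           ≡⟨ filter-++ P? (range n) [ suc n ] ⟩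
    filter P? (range n) ++ filter P? [ suc n ]
      ≡⟨ cong (filter P? (range n) ++_) (filter-reject P? ¬Pn) ⟩
    filter P? (range n) ++ []                  ≡⟨ ++-identityʳ _ ⟩
    filter P? (range n)                        ∎
    where open ≡-Reasoning

  filter-range-gap : ∀ {m n} → m ≤′ n → (∀ {i} → m < i → i ≤ n → ¬ P i) →
                     filter P? (range n) ≡ filter P? (range m)
  filter-range-gap ≤′-refl       _    = refl
  filter-range-gap (≤′-step m≤n) none =
    trans (filter-range-reject (none (s≤s (≤′⇒≤ m≤n)) ≤-refl))
          (filter-range-gap m≤n (λ m<i i≤n → none m<i (m≤n⇒m≤1+n i≤n)))

  filter-range-next : ∀ {m n} → m < n → P n → (∀ {i} → m < i → i < n → ¬ P i) →
                      filter P? (range n) ≡ filter P? (range m) ++ [ n ]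
  filter-range-next (s≤s m≤n) Pn none =
    trans (filter-range-accept Pn)
          (cong (_++ [ _ ]) (filter-range-gap (≤⇒≤′ m≤n) (λ m<i i≤n → none m<i (s≤s i≤n))))

  length-filter-range-accept : ∀ {n} → P (suc n) →
    length (filter P? (range (suc n))) ≡ length (filter P? (range n)) + 1
  length-filter-range-accept {n} Pn =
    trans (cong length (filter-range-accept Pn)) (length-++ (filter P? (range n)))

module _ {p} (pp : Prime p) where

  private
    instance
      p-nonZero : NonZero p
      p-nonZero = prime⇒nonZero pp

  -- Euclid's lemma on 2p = e d: p divides e or d, and the other cofactor divides 2.
  ∣2*p⇒≡1∨≡2∨≡p∨≡2*p : ∀ {d} → d ∣ 2 * p → d ≡ 1 ⊎ d ≡ 2 ⊎ d ≡ p ⊎ d ≡ 2 * p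
  ∣2*p⇒≡1∨≡2∨≡p∨≡2*p {d} (divides e 2p≡ed)
    with euclidsLemma e d pp (divides 2 (sym 2p≡ed))
  ... | inj₁ (divides s refl) = map₂ inj₁ (irreducible[2] (divides s
          (*-cancelʳ-≡ 2 (s * d) p (trans 2p≡ed (xy∙z≈xz∙y s p d)))))
  ... | inj₂ (divides t refl) with irreducible[2] (divides e
          (*-cancelʳ-≡ 2 (e * t) p (trans 2p≡ed (sym (*-assoc e t p)))))
  ...   | inj₁ refl = inj₂ (inj₂ (inj₁ (*-identityˡ p)))
  ...   | inj₂ refl = inj₂ (inj₂ (inj₂ refl))

  divisors[2*p] : 2 < p → divisors (2 * p) ≡ 1 ∷ 2 ∷ p ∷ 2 * p ∷ []
  divisors[2*p] 2<p = begin
    filter D? (range (2 * p))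
      ≡⟨ filter-range-next D? p<2p ∣-refl
           (λ p<i i<2p → excluded (<-trans 2<p p<i) (>⇒≢ p<i) i<2p) ⟩
    filter D? (range p) ++ [ 2 * p ]
      ≡⟨ cong (_++ [ 2 * p ]) (filter-range-next D? 2<p (n∣m*n 2)
           (λ 2<i i<p → excluded 2<i (<⇒≢ i<p) (<-trans i<p p<2p))) ⟩
    (filter D? (range 2) ++ [ p ]) ++ [ 2 * p ]
      ≡⟨ cong (λ xs → (xs ++ [ p ]) ++ [ 2 * p ])
              (filter-range-next D? ≤-refl (divides p (*-comm 2 p)) adjacent) ⟩
    ((filter D? (range 1) ++ [ 2 ]) ++ [ p ]) ++ [ 2 * p ]
      ≡⟨ cong (λ xs → ((xs ++ [ 2 ]) ++ [ p ]) ++ [ 2 * p ])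
              (filter-range-next D? ≤-refl (1∣ _) adjacent) ⟩
    (((filter D? (range 0) ++ [ 1 ]) ++ [ 2 ]) ++ [ p ]) ++ [ 2 * p ] ∎
    where
      open ≡-Reasoning
      D? = _∣? 2 * p
      p<2p : p < 2 * p
      p<2p = subst (p <_) (*-comm p 2) (m<m*n p 2 ≤-refl)
      adjacent : ∀ {m i} → m < i → i < suc m → ¬ i ∣ 2 * p
      adjacent m<i i<1+m _ = <⇒≱ m<i (≤-pred i<1+m)
      excluded : ∀ {i} → 2 < i → i ≢ p → i < 2 * p → ¬ i ∣ 2 * p
      excluded 2<i i≢p i<2p i∣2p with ∣2*p⇒≡1∨≡2∨≡p∨≡2*p i∣2p
      ... | inj₁ refl                = <⇒≱ 2<i (s≤s z≤n)
      ... | inj₂ (inj₁ refl)         = <-irrefl refl 2<i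
      ... | inj₂ (inj₂ (inj₁ i≡p))   = i≢p i≡p
      ... | inj₂ (inj₂ (inj₂ refl))  = <-irrefl refl i<2p

  σ[2*p] : 2 < p → ∀ j → σ j (2 * p) ≡ (1 + 2 ^ j) * (1 + p ^ j)
  σ[2*p] 2<p j = begin
    σ j (2 * p)
      ≡⟨ cong (sum ∘ map (_^ j)) (divisors[2*p] 2<p) ⟩
    1 ^ j + (2 ^ j + (p ^ j + ((2 * p) ^ j + 0)))
      ≡⟨ cong₂ (λ x y → x + (2 ^ j + (p ^ j + (y + 0))))
               (^-zeroˡ j) ([m*n]^k≡m^k*n^k 2 p j) ⟩
    1 + (2 ^ j + (p ^ j + (2 ^ j * p ^ j + 0)))
      ≡⟨ factor (2 ^ j) (p ^ j) ⟩
    (1 + 2 ^ j) * (1 + p ^ j) ∎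
    where
      open ≡-Reasoning
      factor : ∀ x y → 1 + (x + (y + (x * y + 0))) ≡ (1 + x) * (1 + y)
      factor = solve-∀

  gcd[1+2*a,2*p]≡1 : ∀ a → 1 + 2 * a ≢ p → 1 + 2 * a < 2 * p →
                       gcd (1 + 2 * a) (2 * p) ≡ 1
  gcd[1+2*a,2*p]≡1 a odd≢p odd<2p = coprime⇒gcd≡1 common-divisor≡1
    where
      common-divisor≡1 : ∀ {i} → i ∣ 1 + 2 * a × i ∣ 2 * p → i ≡ 1
      common-divisor≡1 (i∣odd , i∣2p) with ∣2*p⇒≡1∨≡2∨≡p∨≡2*p i∣2p
      ... | inj₁ i≡1                = i≡1
      ... | inj₂ (inj₁ refl)        = contradiction i∣odd (2∤1+2*a a)
      ... | inj₂ (inj₂ (inj₁ refl)) =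
        contradiction (m∣n∧0<n<2*m⇒n≡m i∣odd (s≤s z≤n) odd<2p) odd≢p
      ... | inj₂ (inj₂ (inj₂ refl)) = contradiction (∣-trans (m∣m*n p) i∣odd) (2∤1+2*a a)

module OddPrime {q} (pp : Prime (1 + 2 * q)) where

  p : ℕ
  p = 1 + 2 * q

  private
    Coprime? = λ i → gcd i (2 * p) ≟ 1

  count : ℕ → ℕ
  count m = length (filter Coprime? (range m))

  -- Count in pairs (2a + 1, 2a + 2): the even member is never coprime to 2p,
  -- the odd one is unless it equals p.
  count-pair : ∀ a → count (2 * suc a) ≡ count (1 + 2 * a)
  count-pair a =
    trans (cong count (*-suc 2 a)) (cong length (filter-range-reject Coprime? even-not-coprime))
    where
      even-not-coprime : gcd (2 + 2 * a) (2 * p) ≢ 1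
      even-not-coprime =
        d∣m∧d∣n⇒gcd[m,n]≢1 (λ ()) (subst (2 ∣_) (*-suc 2 a) (m∣m*n (suc a))) (m∣m*n p)

  q<p : q < p
  q<p = s≤s (m≤m+n q (q + 0))

  count-odd-step : ∀ {a} → a ≢ q → a < p → count (2 * suc a) ≡ count (2 * a) + 1
  count-odd-step {a} a≢q a<p =
    trans (count-pair a) (length-filter-range-accept Coprime? (gcd[1+2*a,2*p]≡1 pp a odd≢p odd<2p))
    where
      odd≢p : 1 + 2 * a ≢ p
      odd≢p = a≢q ∘ *-cancelˡ-≡ a q 2 ∘ suc-injective
      odd<2p : 1 + 2 * a < 2 * p
      odd<2p = subst (_≤ 2 * p) (*-suc 2 a) (*-monoʳ-≤ 2 a<p)

  count-step-p : count (2 * suc q) ≡ count (2 * q)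
  count-step-p = trans (count-pair q) (cong length (filter-range-reject Coprime? p-not-coprime))
    where
      p-not-coprime : gcd p (2 * p) ≢ 1
      p-not-coprime =
        d∣m∧d∣n⇒gcd[m,n]≢1 (nonTrivial⇒≢1 {{prime⇒nonTrivial pp}}) ∣-refl (n∣m*n 2)

  count-below : ∀ {a} → a ≤ q → count (2 * a) ≡ a
  count-below {zero}  _   = refl
  count-below {suc a} a<q = begin
    count (2 * suc a) ≡⟨ count-odd-step (<⇒≢ a<q) (<-trans a<q q<p) ⟩
    count (2 * a) + 1 ≡⟨ cong (_+ 1) (count-below (<⇒≤ a<q)) ⟩
    a + 1             ≡⟨ +-comm a 1 ⟩
    suc a             ∎
    where open ≡-Reasoning

  count-above : ∀ {a} → q ≤ a → a < p → count (2 * suc a) ≡ a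
  count-above q≤a a<p with m≤n⇒m<n∨m≡n q≤a
  ... | inj₂ refl = trans count-step-p (count-below ≤-refl)
  ... | inj₁ (s≤s {n = a} q≤a) = begin
    count (2 * suc (suc a)) ≡⟨ count-odd-step (>⇒≢ (s≤s q≤a)) a<p ⟩
    count (2 * suc a) + 1   ≡⟨ cong (_+ 1) (count-above q≤a (<-trans (n<1+n a) a<p)) ⟩
    a + 1                   ≡⟨ +-comm a 1 ⟩
    suc a                   ∎
    where open ≡-Reasoning

  φ[2*p]≡2*q : φ (2 * p) ≡ 2 * q
  φ[2*p]≡2*q = count-above (m≤m+n q (q + 0)) ≤-refl

  2<p : 2 < p
  2<p = ≤∧≢⇒< (nonTrivial⇒n>1 p {{prime⇒nonTrivial pp}}) (even≢odd 1 q)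

  ∈S[j]⇒q∣1+2^[1+j] : ∀ j → S j (2 * p) → q ∣ 1 + 2 ^ suc j
  ∈S[j]⇒q∣1+2^[1+j] j (_ , 2pσ≡2) =
    *-cancelˡ-∣ 2 (∣m+n∣m⇒∣n 2q∣2qB+2[1+2T] (m∣m*n B))
    where
      open ≡-Reasoning
      T = 2 ^ j
      a = proj₁ ([1+m]^n≡1+m*k (2 * q) j)
      B = 2 * (1 + T) * (2 + a + 2 * q * a)
      2pσ≡ : 2 * p * σ j (2 * p) ≡ 2 + (2 * q * B + 2 * (1 + 2 * T))
      2pσ≡ = begin
        2 * p * σ j (2 * p)
          ≡⟨ cong (2 * p *_) (σ[2*p] pp 2<p j) ⟩
        2 * p * ((1 + T) * (1 + p ^ j))
          ≡⟨ cong (λ x → 2 * p * ((1 + T) * (1 + x))) (proj₂ ([1+m]^n≡1+m*k (2 * q) j)) ⟩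
        2 * p * ((1 + T) * (1 + (1 + 2 * q * a)))
          ≡⟨ expansion-mod-2q q T a ⟩
        2 + (2 * q * B + 2 * (1 + 2 * T)) ∎
      2q∣2qB+2[1+2T] : 2 * q ∣ 2 * q * B + 2 * (1 + 2 * T)
      2q∣2qB+2[1+2T] =
        2+n≡ₘ2⇒m∣n (subst₂ (λ N m → N ≡ₘ 2 [mod m ]) 2pσ≡ φ[2*p]≡2*q 2pσ≡2)

  ∈S[k]∧∈S[2+k]⇒q∣3 : ∀ k → S k (2 * p) → S (2 + k) (2 * p) → q ∣ 3
  ∈S[k]∧∈S[2+k]⇒q∣3 k 2p∈S[k] 2p∈S[2+k] =
    d∣1+x∧d∣1+4x⇒d∣3 (2 ^ suc k)
      (∈S[j]⇒q∣1+2^[1+j] k 2p∈S[k]) (∈S[j]⇒q∣1+2^[1+j] (2 + k) 2p∈S[2+k])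

q∣3⇒1+2*q≡3∨1+2*q≡7 : ∀ {q} → q ∣ 3 → 1 + 2 * q ≡ 3 ⊎ 1 + 2 * q ≡ 7
q∣3⇒1+2*q≡3∨1+2*q≡7 q∣3 with prime⇒irreducible prime[3] q∣3
... | inj₁ refl = inj₁ refl
... | inj₂ refl = inj₂ refl

corollary3p2 : (p₁ p₂ : ℕ) → Prime p₁ → Prime p₂ → p₁ ≢ 2 → p₂ ≢ 2 → p₁ ≢ p₂ →
    ∃ (λ k → k ≥ 1 × Flanks (2 * p₁) (2 * p₂) 1 k) →
    (p₁ ≡ 3 ⊎ p₁ ≡ 7)
corollary3p2 p₁ _ p₁-prime _ p₁≢2 _ _ (suc k , s≤s z≤n , _ , 2p₁∈S[k] , 2p₁∈S[1+k+1])
  with odd-prime p₁-prime p₁≢2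
... | q , refl = q∣3⇒1+2*q≡3∨1+2*q≡7 (OddPrime.∈S[k]∧∈S[2+k]⇒q∣3 {q} p₁-prime k 2p₁∈S[k] 2p₁∈S[2+k])
  where
    2p₁∈S[2+k] : S (2 + k) (2 * p₁)
    2p₁∈S[2+k] = subst (λ j → S j (2 * p₁)) (cong suc (+-comm k 1)) 2p₁∈S[1+k+1]
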